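{- Let $k\ge 1$. No deterministic online algorithm for unweighted any-order interval selection with revocable decisions achieves a competitive ratio better than $2k$ on instances with at most $k$ distinct interval lengths: for every deterministic online algorithm $A$ there is an instance with at most $k$ distinct interval lengths, together with an arrival order, such that $\mathrm{OPT}\ge 2k\cdot\mathrm{ALG}$.
   Context: Intervals are half-open $[s_i,f_i)$ with $s_i<f_i$ real; two intervals conflict if they intersect. Intervals arrive online one at a time in an order chosen by an adversary. On each arrival the algorithm decides immediately, maintaining at all times a set of pairwise non-conflicting intervals; it may accept the new interval while discarding any currently held intervals that conflict with it (revoking), and a discarded or rejected interval can never be taken again. $\mathrm{ALG}$ is the number of intervals in the algorithm's final solution, $\mathrm{OPT}$ the maximum number of pairwise non-conflicting intervals in the instance; the competitive ratio is $\mathrm{OPT}/\mathrm{ALG}$ with no additive constant. -}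

module Defs where

open import Data.Bool using (Bool; true; false)
open import Data.Nat using (ℕ) renaming (_≤_ to _≤ℕ_)
open import Data.Product using (Σ; _×_; _,_; proj₁)
open import Data.List using (List; []; _∷_; _++_; filter; map; length; deduplicate)
open import Data.List.Relation.Binary.Sublist.Propositional using (_⊆_)
open import Data.List.Relation.Unary.AllPairs using (AllPairs)
open import Data.Rational using (ℚ; _<_; _-_; _≟_; _<?_)
open import Relation.Nullary using (¬_; Dec; yes; no)
open import Relation.Nullary.Decidable using (_×-dec_; ¬?)

-- A half-open interval [s , f) with s < f (rational endpoints).
record Interval : Set where
  constructor [_,_⟩∶_
  field
    s : ℚ
    f : ℚ
    s<f : s < f
open Interval public

len : Interval → ℚ
len I = f I - s I

Conflict : Interval → Interval → Set
Conflict I J = (s I < f J) × (s J < f I)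

conflict? : (I J : Interval) → Dec (Conflict I J)
conflict? I J = (s I <? f J) ×-dec (s J <? f I)

NonConflicting : Interval → Interval → Set
NonConflicting I J = ¬ Conflict I J

-- Since its own past decisions are a function of the history,
-- this captures every deterministic algorithm.
OnlineAlg : Set
OnlineAlg = List Interval → Interval → Bool

step : Bool → Interval → List Interval → List Interval
step true  x held = x ∷ filter (λ y → ¬? (conflict? x y)) held
step false x held = held

run : OnlineAlg → List Interval → List Interval → List Interval → List Interval
run A hist held []       = held
run A hist held (x ∷ xs) = run A (hist ++ (x ∷ [])) (step (A hist x) x held) xs

solution : OnlineAlg → List Interval → List Interval
solution A σ = run A [] [] σ

ALG : OnlineAlg → List Interval → ℕ
ALG A σ = length (solution A σ)

distinctLengths : List Interval → ℕ
distinctLengths σ = length (deduplicate _≟_ (map len σ))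

Feasible : List Interval → List Interval → Set
Feasible σ J = (J ⊆ σ) × AllPairs NonConflicting J

OPT≥ : List Interval → ℕ → Set
OPT≥ σ m = Σ (List Interval) (λ J → Feasible σ J × (m ≤ℕ length J))

-- The adversary works on k nested scales; scale n uses intervals of length 3·9ⁿ whose
-- endpoints lie on the grid of step 9ⁿ inside a window of 9 cells.  Facing an algorithm
-- that holds exactly one interval X covering part of the window, it presents at most four
-- such intervals, each conflicting with whatever the algorithm holds at that moment,
-- following a finite decision tree on the algorithm's answers.  Whatever the answers, the
-- algorithm ends up holding a single interval that covers some cell, while two disjoint
-- presented intervals avoid that cell.  Recursing into the cell at the next scale adds two
-- disjoint intervals per scale, all disjoint from the earlier ones, while the algorithm
-- never holds more than one interval: so OPT ≥ 2k whereas ALG ≤ 1.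
module Submission where

open import Defs
open import Data.Nat using (ℕ; _≤_; _*_)
open import Data.Product using (Σ; _×_)
open import Data.List using (List; [])
open import Relation.Binary.PropositionalEquality using (_≢_)

open import Data.Bool using (true; false)
open import Data.Empty using (⊥-elim)
open import Data.Integer as ℤ using (+_)
import Data.Integer.Properties as ℤ
open import Data.List using (_∷_; _++_; map; length)
open import Data.List.Properties using (map-++; ++-assoc; filter-reject; length-removeAt′)
open import Data.List.Membership.Propositional using (_∈_)
open import Data.List.Relation.Unary.Any using (here; there; _─_)
open import Data.List.Relation.Unary.All as All using (All; []; _∷_)
open import Data.List.Relation.Unary.All.Properties using (map⁺; deduplicate⁺)
open import Data.List.Relation.Unary.AllPairs using (AllPairs; []; _∷_)
open import Data.List.Relation.Unary.Unique.Propositional using (Unique)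
open import Data.List.Relation.Unary.Unique.DecPropositional.Properties using (deduplicate-!)
open import Data.List.Relation.Binary.Sublist.Propositional using (_⊆_; []; _∷ʳ_)
import Data.List.Relation.Binary.Sublist.Propositional.Properties as Sublist
open import Data.Nat as ℕ using (zero; suc; _+_; _<_; _≤?_; _<?_; z≤n; s≤s; NonZero; _^_)
import Data.Nat.Properties as ℕ
import Data.Nat.Coprimality as Coprimality
open import Data.List.Relation.Binary.Sublist.DecPropositional ℕ._≟_ using (_⊆?_)
open import Data.Product using (_,_; proj₁; proj₂)
open import Data.Rational as ℚ using (ℚ; mkℚ; *<*; *≤*)
import Data.Rational.Properties as ℚ
import Data.Rational.Unnormalised as ℚᵘ
import Data.Rational.Unnormalised.Properties as ℚᵘ
open import Data.Sum using (_⊎_; inj₁; inj₂)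
open import Relation.Binary.PropositionalEquality
  using (_≡_; refl; sym; cong; cong₂; subst; subst₂; trans; ≢-sym; module ≡-Reasoning)
open import Relation.Nullary.Decidable using (Dec; True; toWitness; ¬?; _×-dec_; _⊎-dec_)

fromℕ : ℕ → ℚ
fromℕ n = mkℚ (+ n) 0 (Coprimality.sym (Coprimality.1-coprimeTo n))

fromℕ-mono-< : ∀ {m n} → m < n → fromℕ m ℚ.< fromℕ n
fromℕ-mono-< {m} {n} m<n =
  *<* (subst₂ ℤ._<_ (sym (ℤ.*-identityʳ (+ m))) (sym (ℤ.*-identityʳ (+ n))) (ℤ.+<+ m<n))

fromℕ-mono-≤ : ∀ {m n} → m ≤ n → fromℕ m ℚ.≤ fromℕ n
fromℕ-mono-≤ {m} {n} m≤n =
  *≤* (subst₂ ℤ._≤_ (sym (ℤ.*-identityʳ (+ m))) (sym (ℤ.*-identityʳ (+ n))) (ℤ.+≤+ m≤n))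

fromℕ-homo-+ : ∀ m n → fromℕ (m + n) ≡ fromℕ m ℚ.+ fromℕ n
fromℕ-homo-+ m n = ℚ.toℚᵘ-injective
  (ℚᵘ.≃-trans (ℚᵘ.*≡* numerators) (ℚᵘ.≃-sym (ℚ.toℚᵘ-homo-+ (fromℕ m) (fromℕ n))))
  where
  open ≡-Reasoning
  numerators : + (m + n) ℤ.* + 1 ≡ (+ m ℤ.* + 1 ℤ.+ + n ℤ.* + 1) ℤ.* + 1
  numerators = begin
    + (m + n) ℤ.* + 1                     ≡⟨ ℤ.*-identityʳ _ ⟩
    + (m + n)                             ≡⟨ ℤ.pos-+ m n ⟩
    + m ℤ.+ + n                           ≡⟨ sym (cong₂ ℤ._+_ (ℤ.*-identityʳ (+ m)) (ℤ.*-identityʳ (+ n))) ⟩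
    + m ℤ.* + 1 ℤ.+ + n ℤ.* + 1           ≡⟨ sym (ℤ.*-identityʳ _) ⟩
    (+ m ℤ.* + 1 ℤ.+ + n ℤ.* + 1) ℤ.* + 1 ∎

p+q-p≡q : ∀ p q → (p ℚ.+ q) ℚ.- p ≡ q
p+q-p≡q p q = begin
  (p ℚ.+ q) ℚ.- p   ≡⟨ cong (ℚ._- p) (ℚ.+-comm p q) ⟩
  (q ℚ.+ p) ℚ.- p   ≡⟨ ℚ.+-assoc q p (ℚ.- p) ⟩
  q ℚ.+ (p ℚ.- p)   ≡⟨ cong (q ℚ.+_) (ℚ.+-inverseʳ p) ⟩
  q ℚ.+ ℚ.0ℚ        ≡⟨ ℚ.+-identityʳ q ⟩
  q                 ∎
  where open ≡-Reasoning

interval : (m n : ℕ) → m < n → Interval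
interval m n m<n = [ fromℕ m , fromℕ n ⟩∶ fromℕ-mono-< m<n

len-interval : ∀ m n l (m<n : m < n) → n ≡ l + m → len (interval m n m<n) ≡ fromℕ l
len-interval m n l m<n refl =
  trans (cong (ℚ._- fromℕ m) (trans (fromℕ-homo-+ l m) (ℚ.+-comm (fromℕ l) (fromℕ m))))
        (p+q-p≡q (fromℕ m) (fromℕ l))

separated⇒nonConflicting : ∀ {I J} → f I ℚ.≤ s J ⊎ f J ℚ.≤ s I → NonConflicting I J
separated⇒nonConflicting (inj₁ fI≤sJ) (_ , sJ<fI) = ℚ.<-irrefl refl (ℚ.<-≤-trans sJ<fI fI≤sJ)
separated⇒nonConflicting (inj₂ fJ≤sI) (sI<fJ , _) = ℚ.<-irrefl refl (ℚ.<-≤-trans sI<fJ fJ≤sI)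

Inside : ℕ → ℕ → Interval → Set
Inside lo hi I = fromℕ lo ℚ.≤ s I × f I ℚ.≤ fromℕ hi

Covers : ℕ → ℕ → Interval → Set
Covers lo hi X = s X ℚ.≤ fromℕ lo × fromℕ hi ℚ.≤ f X

inside-mono : ∀ {lo hi lo′ hi′} → lo ≤ lo′ → hi′ ≤ hi → ∀ {I} → Inside lo′ hi′ I → Inside lo hi I
inside-mono lo≤lo′ hi′≤hi (lo′≤s , f≤hi′) =
  ℚ.≤-trans (fromℕ-mono-≤ lo≤lo′) lo′≤s , ℚ.≤-trans f≤hi′ (fromℕ-mono-≤ hi′≤hi)

outside⇒nonConflicting : ∀ {lo hi I J} → f I ℚ.≤ fromℕ lo ⊎ fromℕ hi ℚ.≤ s I →
                         Inside lo hi J → NonConflicting I J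
outside⇒nonConflicting {I = I} {J} (inj₁ fI≤lo) (lo≤sJ , _) =
  separated⇒nonConflicting {I} {J} (inj₁ (ℚ.≤-trans fI≤lo lo≤sJ))
outside⇒nonConflicting {I = I} {J} (inj₂ hi≤sI) (_ , fJ≤hi) =
  separated⇒nonConflicting {I} {J} (inj₂ (ℚ.≤-trans fJ≤hi hi≤sI))

∈-─ : ∀ {a} {A : Set a} {x y : A} {xs} (y∈xs : y ∈ xs) → x ∈ xs → x ≢ y → x ∈ (xs ─ y∈xs)
∈-─ (here refl) (here refl) x≢y = ⊥-elim (x≢y refl)
∈-─ (here refl) (there x∈xs) _ = x∈xs
∈-─ (there y∈xs) (here refl) _ = here refl
∈-─ (there y∈xs) (there x∈xs) x≢y = there (∈-─ y∈xs x∈xs x≢y)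

unique⇒length≤ : ∀ {a} {A : Set a} {xs ys : List A} → Unique ys → All (_∈ xs) ys → length ys ≤ length xs
unique⇒length≤ [] [] = z≤n
unique⇒length≤ {xs = xs} (y≢ys ∷ unique) (y∈xs ∷ ys∈xs) =
  subst (_ ≤_) (sym (length-removeAt′ xs _))
    (s≤s (unique⇒length≤ unique
      (All.zipWith (λ (z∈xs , y≢z) → ∈-─ y∈xs z∈xs (≢-sym y≢z)) (ys∈xs , y≢ys))))

distinctLengths≤ : ∀ {σ Ls} → All (λ I → len I ∈ Ls) σ → distinctLengths σ ≤ length Ls
distinctLengths≤ {σ} lens∈ =
  unique⇒length≤ (deduplicate-! ℚ._≟_ (map len σ)) (deduplicate⁺ ℚ._≟_ (map⁺ lens∈))

-- Positions are counted in cells of a grid: cell t is [grid t , grid (suc t)) and block x,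
-- the only kind of interval presented at a scale, is [grid x , grid (3 + x)).
grid : (u p x : ℕ) → ℕ
grid u p x = x * u + p

Apart : ℕ → ℕ → Set
Apart a b = 3 + a ≤ b ⊎ 3 + b ≤ a

Misses : ℕ → ℕ → Set
Misses a t = 3 + a ≤ t ⊎ suc t ≤ a

Meets : ℕ → ℕ → ℕ → Set
Meets x hx hy = hx < 3 + x × x < hy

meets? : ∀ x hx hy → Dec (Meets x hx hy)
meets? x hx hy = hx <? 3 + x ×-dec x <? hy

Finishable : List ℕ → ℕ → ℕ → ℕ → ℕ → ℕ → Set
Finishable path hx hy a b t =
  (a ∷ b ∷ []) ⊆ path × 3 + a ≤ 9 × 3 + b ≤ 9 × Apart a b × Misses a t × Misses b t ×
  hx ≤ t × t < hy × t < 9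

finishable? : ∀ path hx hy a b t → Dec (Finishable path hx hy a b t)
finishable? path hx hy a b t =
  (a ∷ b ∷ []) ⊆? path ×-dec 3 + a ≤? 9 ×-dec 3 + b ≤? 9 ×-dec
  (3 + a ≤? b ⊎-dec 3 + b ≤? a) ×-dec (3 + a ≤? t ⊎-dec suc t ≤? a) ×-dec
  (3 + b ≤? t ⊎-dec suc t ≤? b) ×-dec hx ≤? t ×-dec t <? hy ×-dec t <? 9

lengths : ℕ → List ℚ
lengths zero = []
lengths (suc n) = fromℕ (3 * 9 ^ n) ∷ lengths n

length-lengths : ∀ n → length (lengths n) ≡ n
length-lengths zero = refl
length-lengths (suc n) = cong suc (length-lengths n)

data Strategy : Set where
  finish : (a b t : ℕ) → Strategy
  present : (x : ℕ) (ifAccepted ifRejected : Strategy) → Strategy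

-- The algorithm holds an interval covering the cells [hx , hy), and path lists the blocks
-- presented so far at this scale, in order.
Wins : List ℕ → ℕ → ℕ → Strategy → Set
Wins path hx hy (finish a b t) = True (finishable? path hx hy a b t)
Wins path hx hy (present x acc rej) =
  True (meets? x hx hy) × Wins (path ++ x ∷ []) x (3 + x) acc × Wins (path ++ x ∷ []) hx hy rej

afterOpening : Strategy
afterOpening =
  present 4 (present 5 (present 6 (finish 2 5 8) (finish 2 6 5))
                       (present 6 (finish 2 5 8) (finish 2 6 5)))
            (present 0 (present 1 (finish 4 0 3) (finish 4 1 0))
                       (finish 4 0 3))

strategy : Strategy
strategy =
  present 2 afterOpening
    (present 3 (present 5 (present 6 (finish 2 5 8) (finish 2 6 5))
                          (present 1 (finish 2 5 1) (finish 5 1 4)))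
               (present 5 (present 6 (finish 2 5 8) (finish 2 6 5))
                          (finish 2 5 0)))

-- Every condition is a closed decidable one, so the check is carried out by evaluation.
strategy-wins : Wins [] 0 9 strategy
strategy-wins = _

module _ (A : OnlineAlg) where

  run-accept : ∀ {hist I X} → A hist I ≡ true → Conflict I X → ∀ σ →
               run A hist (X ∷ []) (I ∷ σ) ≡ run A (hist ++ I ∷ []) (I ∷ []) σ
  run-accept {hist} {I} {X} accepted conflict σ
    rewrite accepted
          | filter-reject (λ J → ¬? (conflict? I J)) {X} {[]} (λ ¬conflict → ¬conflict conflict) = refl

  run-reject : ∀ {hist I X} → A hist I ≡ false → ∀ σ →
               run A hist (X ∷ []) (I ∷ σ) ≡ run A (hist ++ I ∷ []) (X ∷ []) σ
  run-reject accepted σ rewrite accepted = refl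

  -- From history hist, with the algorithm holding exactly X, the arrivals leave it holding a
  -- single interval, while 2c pairwise disjoint intervals inside [lo , hi] are found among
  -- the arrivals and the earlier intervals pre.
  record Forcing (Ls : List ℚ) (pre hist : List Interval) (X : Interval) (lo hi c : ℕ) : Set where
    field
      arrivals : List Interval
      final : Interval
      run-final : run A hist (X ∷ []) arrivals ≡ final ∷ []
      arrivals-len∈ : All (λ I → len I ∈ Ls) arrivals
      packing : List Interval
      packing-⊆ : packing ⊆ pre ++ arrivals
      packing-disjoint : AllPairs NonConflicting packing
      packing-length : length packing ≡ 2 * c
      packing-inside : All (Inside lo hi) packing
  open Forcing

  idle : ∀ {Ls hist X lo hi} → Forcing Ls [] hist X lo hi 0
  idle = record
    { arrivals = [] ; final = _ ; run-final = refl ; arrivals-len∈ = []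
    ; packing = [] ; packing-⊆ = [] ; packing-disjoint = [] ; packing-length = refl ; packing-inside = [] }

  prepend : ∀ {Ls pre hist X Y lo hi c I} → len I ∈ Ls →
            (∀ σ → run A hist (X ∷ []) (I ∷ σ) ≡ run A (hist ++ I ∷ []) (Y ∷ []) σ) →
            Forcing Ls (pre ++ I ∷ []) (hist ++ I ∷ []) Y lo hi c → Forcing Ls pre hist X lo hi c
  prepend {pre = pre} {I = I} len∈ first-step r = record
    { arrivals = I ∷ arrivals r
    ; final = final r
    ; run-final = trans (first-step (arrivals r)) (run-final r)
    ; arrivals-len∈ = len∈ ∷ arrivals-len∈ r
    ; packing = packing r
    ; packing-⊆ = subst (packing r ⊆_) (++-assoc pre (I ∷ []) (arrivals r)) (packing-⊆ r)
    ; packing-disjoint = packing-disjoint r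
    ; packing-length = packing-length r
    ; packing-inside = packing-inside r
    }

  module Scale (Ls : List ℚ) (u p : ℕ) .{{_ : NonZero u}} (3u∈Ls : fromℕ (3 * u) ∈ Ls) (c : ℕ)
    (inCell : ∀ hist X t → t < 9 → Covers (grid u p t) (grid u p (suc t)) X →
              Forcing Ls [] hist X (grid u p t) (grid u p (suc t)) c) where

    grid-mono-< : ∀ {x y} → x < y → grid u p x < grid u p y
    grid-mono-< x<y = ℕ.+-monoˡ-< p (ℕ.*-monoˡ-< u x<y)

    grid-mono-≤ : ∀ {x y} → x ≤ y → grid u p x ≤ grid u p y
    grid-mono-≤ x≤y = ℕ.+-monoˡ-≤ p (ℕ.*-monoˡ-≤ u x≤y)

    fromℕ-grid-mono-≤ : ∀ {x y} → x ≤ y → fromℕ (grid u p x) ℚ.≤ fromℕ (grid u p y)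
    fromℕ-grid-mono-≤ x≤y = fromℕ-mono-≤ (grid-mono-≤ x≤y)

    fromℕ-grid-mono-< : ∀ {x y} → x < y → fromℕ (grid u p x) ℚ.< fromℕ (grid u p y)
    fromℕ-grid-mono-< x<y = fromℕ-mono-< (grid-mono-< x<y)

    block-ends : ∀ x → grid u p x < grid u p (3 + x)
    block-ends x = grid-mono-< (ℕ.m<n+m x {3} (s≤s z≤n))

    block : ℕ → Interval
    block x = interval (grid u p x) (grid u p (3 + x)) (block-ends x)

    len-block : ∀ x → len (block x) ≡ fromℕ (3 * u)
    len-block x = len-interval _ _ (3 * u) (block-ends x) right-end
      where
      right-end : (3 + x) * u + p ≡ 3 * u + (x * u + p)
      right-end = trans (cong (_+ p) (ℕ.*-distribʳ-+ u 3 x)) (ℕ.+-assoc (3 * u) (x * u) p)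

    len-block∈ : ∀ x → len (block x) ∈ Ls
    len-block∈ x = subst (_∈ Ls) (sym (len-block x)) 3u∈Ls

    block-conflicts : ∀ {hx hy x X} → hx < 3 + x → x < hy → Covers (grid u p hx) (grid u p hy) X →
                      Conflict (block x) X
    block-conflicts hx<3+x x<hy (sX≤hx , hy≤fX) =
      ℚ.<-≤-trans (fromℕ-grid-mono-< x<hy) hy≤fX , ℚ.≤-<-trans sX≤hx (fromℕ-grid-mono-< hx<3+x)

    apart⇒nonConflicting : ∀ {a b} → Apart a b → NonConflicting (block a) (block b)
    apart⇒nonConflicting {a} {b} (inj₁ 3+a≤b) =
      separated⇒nonConflicting {block a} {block b} (inj₁ (fromℕ-grid-mono-≤ 3+a≤b))
    apart⇒nonConflicting {a} {b} (inj₂ 3+b≤a) =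
      separated⇒nonConflicting {block a} {block b} (inj₂ (fromℕ-grid-mono-≤ 3+b≤a))

    misses⇒outside : ∀ {a t} → Misses a t →
                     f (block a) ℚ.≤ fromℕ (grid u p t) ⊎ fromℕ (grid u p (suc t)) ℚ.≤ s (block a)
    misses⇒outside (inj₁ 3+a≤t) = inj₁ (fromℕ-grid-mono-≤ 3+a≤t)
    misses⇒outside (inj₂ 1+t≤a) = inj₂ (fromℕ-grid-mono-≤ 1+t≤a)

    block-inside : ∀ {a} → 3 + a ≤ 9 → Inside (grid u p 0) (grid u p 9) (block a)
    block-inside {a} 3+a≤9 = fromℕ-grid-mono-≤ {0} {a} z≤n , fromℕ-grid-mono-≤ {3 + a} 3+a≤9

    presenting : ∀ {path hist X Y lo hi c′} x →
                 (∀ σ → run A hist (X ∷ []) (block x ∷ σ) ≡ run A (hist ++ block x ∷ []) (Y ∷ []) σ) →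
                 Forcing Ls (map block (path ++ x ∷ [])) (hist ++ block x ∷ []) Y lo hi c′ →
                 Forcing Ls (map block path) hist X lo hi c′
    presenting {path} x first-step r =
      prepend (len-block∈ x) first-step
        (subst (λ pre → Forcing Ls pre _ _ _ _ _) (map-++ block path (x ∷ [])) r)

    finishing : ∀ {path hx hy a b t} → Finishable path hx hy a b t → ∀ {hist X} →
                Covers (grid u p hx) (grid u p hy) X →
                Forcing Ls (map block path) hist X (grid u p 0) (grid u p 9) (suc c)
    finishing {hx = hx} {a = a} {b} {t}
              (ab⊆path , 3+a≤9 , 3+b≤9 , apart , a-misses , b-misses , hx≤t , t<hy , t<9)
              {hist} {X} (sX≤hx , hy≤fX) = record
      { arrivals = arrivals r
      ; final = final r
      ; run-final = run-final r
      ; arrivals-len∈ = arrivals-len∈ r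
      ; packing = block a ∷ block b ∷ packing r
      ; packing-⊆ = Sublist.++⁺ (Sublist.map⁺ block ab⊆path) (packing-⊆ r)
      ; packing-disjoint =
          (apart⇒nonConflicting {a} {b} apart ∷ clear a-misses) ∷ clear b-misses ∷ packing-disjoint r
      ; packing-length = trans (cong (λ n → 2 + n) (packing-length r)) (sym (ℕ.*-suc 2 c))
      ; packing-inside = block-inside 3+a≤9 ∷ block-inside 3+b≤9 ∷
          All.map (λ {I} → inside-mono (grid-mono-≤ {0} {t} z≤n) (grid-mono-≤ {suc t} t<9) {I})
                  (packing-inside r)
      }
      where
      r : Forcing Ls [] hist X (grid u p t) (grid u p (suc t)) c
      r = inCell hist X t t<9
            (ℚ.≤-trans sX≤hx (fromℕ-grid-mono-≤ {hx} hx≤t) , ℚ.≤-trans (fromℕ-grid-mono-≤ {suc t} t<hy) hy≤fX)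
      clear : ∀ {x} → Misses x t → All (NonConflicting (block x)) (packing r)
      clear {x} misses =
        All.map (λ {J} → outside⇒nonConflicting {I = block x} {J} (misses⇒outside {x} {t} misses))
                (packing-inside r)

    play : ∀ T {path hx hy} → Wins path hx hy T → ∀ {hist X} → Covers (grid u p hx) (grid u p hy) X →
           Forcing Ls (map block path) hist X (grid u p 0) (grid u p 9) (suc c)
    play (finish a b t) wins = finishing (toWitness wins)
    play (present x acc rej) {hx = hx} {hy} (meets , wins-acc , wins-rej) {hist} {X} covers
      with A hist (block x) in decision | toWitness meets
    ... | true | hx<3+x , x<hy =
      presenting x (run-accept decision (block-conflicts {hx} {hy} {x} {X} hx<3+x x<hy covers))
        (play acc wins-acc (ℚ.≤-refl , ℚ.≤-refl))
    ... | false | _ =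
      presenting x (run-reject decision) (play rej wins-rej covers)

  lengths-there : ∀ {ℓ Ls pre hist X lo hi c} →
                  Forcing Ls pre hist X lo hi c → Forcing (ℓ ∷ Ls) pre hist X lo hi c
  lengths-there r = record
    { arrivals = arrivals r
    ; final = final r
    ; run-final = run-final r
    ; arrivals-len∈ = All.map there (arrivals-len∈ r)
    ; packing = packing r
    ; packing-⊆ = packing-⊆ r
    ; packing-disjoint = packing-disjoint r
    ; packing-length = packing-length r
    ; packing-inside = packing-inside r
    }

  mutual
    forcing : ∀ n p {hist X} → Covers p (9 ^ suc n + p) X →
            Forcing (lengths (suc n)) [] hist X p (9 ^ suc n + p) (suc n)
    forcing n p = Scale.play (lengths (suc n)) (9 ^ n) p {{ℕ.m^n≢0 9 n}} (here refl) n (forcingInCell n p)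
                  strategy {[]} {0} {9} strategy-wins

    forcingInCell : ∀ n p hist X t → t < 9 → Covers (grid (9 ^ n) p t) (grid (9 ^ n) p (suc t)) X →
            Forcing (lengths (suc n)) [] hist X (grid (9 ^ n) p t) (grid (9 ^ n) p (suc t)) n
    forcingInCell zero p hist X t _ covers = idle
    forcingInCell (suc m) p hist X t _ covers =
      lengths-there (subst (λ hi → Forcing (lengths (suc m)) [] hist X bottom hi (suc m)) (sym top)
        (forcing m bottom (subst (λ hi → Covers bottom hi X) top covers)))
      where
      bottom : ℕ
      bottom = grid (9 ^ suc m) p t
      top : grid (9 ^ suc m) p (suc t) ≡ 9 ^ suc m + bottom
      top = ℕ.+-assoc (9 ^ suc m) (t * 9 ^ suc m) p

  module Coarsest (n : ℕ) =
    Scale (lengths (suc n)) (9 ^ n) 0 {{ℕ.m^n≢0 9 n}} (here refl) n (forcingInCell n 0)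

  opening : ℕ → Interval
  opening n = Coarsest.block n 2

  ALG-rejected : ∀ {I} → A [] I ≡ false → ALG A (I ∷ []) ≡ 0
  ALG-rejected rejected rewrite rejected = refl

  ALG-accepted : ∀ {I σ J} → A [] I ≡ true → run A (I ∷ []) (I ∷ []) σ ≡ J ∷ [] → ALG A (I ∷ σ) ≡ 1
  ALG-accepted accepted final-held rewrite accepted = cong length final-held

  adversary : ∀ n → Σ (List Interval) (λ σ →
              (σ ≢ []) × (distinctLengths σ ≤ suc n) × OPT≥ σ ((2 * suc n) * ALG A σ))
  adversary n with A [] (opening n) in decision
  ... | false = opening n ∷ [] , (λ ()) , s≤s z≤n , [] , (opening n ∷ʳ [] , []) , ℕ.≤-reflexive alg≡0
    where
    alg≡0 : (2 * suc n) * ALG A (opening n ∷ []) ≡ 0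
    alg≡0 = trans (cong ((2 * suc n) *_) (ALG-rejected decision)) (ℕ.*-zeroʳ (2 * suc n))
  ... | true =
    opening n ∷ arrivals r , (λ ()) , distinct , packing r , (packing-⊆ r , packing-disjoint r) ,
    ℕ.≤-reflexive alg≡2k
    where
    open Coarsest n
    r : Forcing (lengths (suc n)) (opening n ∷ []) (opening n ∷ []) (opening n)
                (grid (9 ^ n) 0 0) (grid (9 ^ n) 0 9) (suc n)
    r = play afterOpening {2 ∷ []} {2} {5} (proj₁ (proj₂ strategy-wins)) (ℚ.≤-refl , ℚ.≤-refl)
    distinct : distinctLengths (opening n ∷ arrivals r) ≤ suc n
    distinct = subst (distinctLengths (opening n ∷ arrivals r) ≤_) (length-lengths (suc n))
                 (distinctLengths≤ {opening n ∷ arrivals r} (len-block∈ 2 ∷ arrivals-len∈ r))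
    alg≡2k : (2 * suc n) * ALG A (opening n ∷ arrivals r) ≡ length (packing r)
    alg≡2k = begin
      (2 * suc n) * ALG A (opening n ∷ arrivals r)
        ≡⟨ cong ((2 * suc n) *_) (ALG-accepted {opening n} {arrivals r} decision (run-final r)) ⟩
      (2 * suc n) * 1
        ≡⟨ ℕ.*-identityʳ (2 * suc n) ⟩
      2 * suc n
        ≡⟨ sym (packing-length r) ⟩
      length (packing r) ∎
      where open ≡-Reasoning

theorem2 : (k : ℕ) → 1 ≤ k → (A : OnlineAlg) →
    Σ (List Interval) (λ σ →
      (σ ≢ []) × (distinctLengths σ ≤ k) × OPT≥ σ ((2 * k) * ALG A σ))
theorem2 (suc n) _ A = adversary A n
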